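{- Let $\Sigma$ be a finite alphabet and let $e,f\in\mathrm{RegE}(\Sigma)$ contain none of $0$, $\top$, $\sqcap$. If $e$ is a subobject of $f$ (i.e. $f\to^*e$), then $\mathsf{pSRKA}$ derives $e\le f$.
   Context: $\mathrm{RegE}(\Sigma)$ is generated by $e::=a\ (a\in\Sigma)\mid0\mid\top\mid1\mid e\sqcup e\mid e\sqcap e\mid e\star e\mid e^\diamond$. The transition relation $\to$ is the least relation with $e\sqcup f\to e$, $e\sqcup f\to f$, $e\sqcap f\to e$, $e\sqcap f\to f$, $a\to1$ ($a\in\Sigma$), $e\star1\to e$, $e^\diamond\to1$, $e^\diamond\to e^\diamond\star e$, and $g\star e\to g\star f$ whenever $e\to f$; $\to^*$ is its reflexive transitive closure, and $e$ is a subobject of $f$ when $f\to^*e$. $\mathsf{pSRKA}$: reflexivity $a\le a$ and the following axiom schemes / Horn rules for arbitrary expressions $a,b,c,a',b',x,y$ ($a=b$ abbreviates both inequalities): $a\le b\wedge b\le c\Rightarrow a\le c$; $a\le a\sqcup b$; $b\le a\sqcup b$; $b\le a\wedge c\le a\Rightarrow b\sqcup c\le a$; $a\star1=a=1\star a$; $a\star(b\star c)=(a\star b)\star c$; $a\le a'\wedge b\le b'\Rightarrow a\star b\le a'\star b'$; $a\star(b\sqcup c)\le(a\star b)\sqcup(a\star c)$; $1\le a^\diamond$; $a^\diamond\star a\le a^\diamond$; $x\star y\le x\Rightarrow x\star y^\diamond\le x$; $1\le a$. -}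

module Defs where

open import Data.Nat using (ℕ)
open import Data.Fin using (Fin)
open import Relation.Binary.Construct.Closure.ReflexiveTransitive using (Star)

data RegE (Σ : Set) : Set where
  lit  : Σ → RegE Σ
  𝟘    : RegE Σ
  ⊤ᵉ   : RegE Σ
  𝟙    : RegE Σ
  _⊔_  : RegE Σ → RegE Σ → RegE Σ
  _⊓_  : RegE Σ → RegE Σ → RegE Σ
  _⋆_  : RegE Σ → RegE Σ → RegE Σ
  _◇   : RegE Σ → RegE Σ

infixl 6 _⊔_
infixl 6 _⊓_
infixl 7 _⋆_
infix  8 _◇

data _⟶_ {Σ : Set} : RegE Σ → RegE Σ → Set where
  ⊔-l   : ∀ {e f} → (e ⊔ f) ⟶ e
  ⊔-r   : ∀ {e f} → (e ⊔ f) ⟶ f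
  ⊓-l   : ∀ {e f} → (e ⊓ f) ⟶ e
  ⊓-r   : ∀ {e f} → (e ⊓ f) ⟶ f
  lit-1 : ∀ {a} → lit a ⟶ 𝟙
  ⋆-1   : ∀ {e} → (e ⋆ 𝟙) ⟶ e
  ◇-1   : ∀ {e} → (e ◇) ⟶ 𝟙
  ◇-unf : ∀ {e} → (e ◇) ⟶ ((e ◇) ⋆ e)
  ⋆-cong : ∀ {g e f} → e ⟶ f → (g ⋆ e) ⟶ (g ⋆ f)

infix 4 _⟶_
infix 4 _⟶*_

_⟶*_ : {Σ : Set} → RegE Σ → RegE Σ → Set
_⟶*_ = Star _⟶_

Subobject : {Σ : Set} → RegE Σ → RegE Σ → Set
Subobject e f = f ⟶* e

data Plain {Σ : Set} : RegE Σ → Set where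
  lit : ∀ a → Plain (lit a)
  𝟙   : Plain 𝟙
  _⊔_ : ∀ {e f} → Plain e → Plain f → Plain (e ⊔ f)
  _⋆_ : ∀ {e f} → Plain e → Plain f → Plain (e ⋆ f)
  _◇  : ∀ {e} → Plain e → Plain (e ◇)

infix 3 pSRKA⊢_≤_
data pSRKA⊢_≤_ {Σ : Set} : RegE Σ → RegE Σ → Set where
  refl′   : ∀ {a} → pSRKA⊢ a ≤ a
  trans′  : ∀ {a b c} → pSRKA⊢ a ≤ b → pSRKA⊢ b ≤ c → pSRKA⊢ a ≤ c
  ⊔-inl   : ∀ {a b} → pSRKA⊢ a ≤ a ⊔ b
  ⊔-inr   : ∀ {a b} → pSRKA⊢ b ≤ a ⊔ b
  ⊔-lub   : ∀ {a b c} → pSRKA⊢ b ≤ a → pSRKA⊢ c ≤ a → pSRKA⊢ b ⊔ c ≤ a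
  ⋆-unitʳ-≤ : ∀ {a} → pSRKA⊢ a ⋆ 𝟙 ≤ a
  ⋆-unitʳ-≥ : ∀ {a} → pSRKA⊢ a ≤ a ⋆ 𝟙
  ⋆-unitˡ-≤ : ∀ {a} → pSRKA⊢ 𝟙 ⋆ a ≤ a
  ⋆-unitˡ-≥ : ∀ {a} → pSRKA⊢ a ≤ 𝟙 ⋆ a
  ⋆-assoc-≤ : ∀ {a b c} → pSRKA⊢ a ⋆ (b ⋆ c) ≤ (a ⋆ b) ⋆ c
  ⋆-assoc-≥ : ∀ {a b c} → pSRKA⊢ (a ⋆ b) ⋆ c ≤ a ⋆ (b ⋆ c)
  ⋆-mono  : ∀ {a a′ b b′} → pSRKA⊢ a ≤ a′ → pSRKA⊢ b ≤ b′ → pSRKA⊢ a ⋆ b ≤ a′ ⋆ b′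
  ⋆-distrib : ∀ {a b c} → pSRKA⊢ a ⋆ (b ⊔ c) ≤ (a ⋆ b) ⊔ (a ⋆ c)
  ◇-unit  : ∀ {a} → pSRKA⊢ 𝟙 ≤ a ◇
  ◇-unfold : ∀ {a} → pSRKA⊢ (a ◇) ⋆ a ≤ a ◇
  ◇-ind   : ∀ {x y} → pSRKA⊢ x ⋆ y ≤ x → pSRKA⊢ x ⋆ (y ◇) ≤ x
  𝟙-bot   : ∀ {a} → pSRKA⊢ 𝟙 ≤ a

{-# OPTIONS --safe #-}
module Submission where

open import Defs
open import Data.Nat using (ℕ)
open import Data.Fin using (Fin)
open import Relation.Binary.Construct.Closure.ReflexiveTransitive using (ε; _◅_)

-- Every transition rule except the two ⊓-rules moves down in pSRKA (the target
-- is below the source), and plain expressions only ever step to plain ones.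

module _ {Σ : Set} where

  ⟶-preserves-Plain : ∀ {e f : RegE Σ} → Plain e → e ⟶ f → Plain f
  ⟶-preserves-Plain (p ⊔ _) ⊔-l        = p
  ⟶-preserves-Plain (_ ⊔ q) ⊔-r        = q
  ⟶-preserves-Plain (lit _) lit-1      = 𝟙
  ⟶-preserves-Plain (p ⋆ _) ⋆-1        = p
  ⟶-preserves-Plain (p ◇)   ◇-1        = 𝟙
  ⟶-preserves-Plain (p ◇)   ◇-unf      = p ◇ ⋆ p
  ⟶-preserves-Plain (p ⋆ q) (⋆-cong s) = p ⋆ ⟶-preserves-Plain q s

  ⟶⇒≥ : ∀ {e f : RegE Σ} → Plain e → e ⟶ f → pSRKA⊢ f ≤ e
  ⟶⇒≥ (_ ⊔ _) ⊔-l        = ⊔-inl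
  ⟶⇒≥ (_ ⊔ _) ⊔-r        = ⊔-inr
  ⟶⇒≥ (lit _) lit-1      = 𝟙-bot
  ⟶⇒≥ (_ ⋆ _) ⋆-1        = ⋆-unitʳ-≥
  ⟶⇒≥ (_ ◇)   ◇-1        = ◇-unit
  ⟶⇒≥ (_ ◇)   ◇-unf      = ◇-unfold
  ⟶⇒≥ (_ ⋆ q) (⋆-cong s) = ⋆-mono refl′ (⟶⇒≥ q s)

  ⟶*⇒≥ : ∀ {e f : RegE Σ} → Plain e → e ⟶* f → pSRKA⊢ f ≤ e
  ⟶*⇒≥ p ε        = refl′
  ⟶*⇒≥ p (s ◅ ss) = trans′ (⟶*⇒≥ (⟶-preserves-Plain p s) ss) (⟶⇒≥ p s)

lemma4p19 : (n : ℕ) (e f : RegE (Fin n)) → Plain e → Plain f →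
    Subobject e f → pSRKA⊢ e ≤ f
lemma4p19 n e f _ plain-f f⟶*e = ⟶*⇒≥ plain-f f⟶*e
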